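{- The series $\sum_{i=0}^\infty\tau_i$ converges.
   Context: $\ell$ is an odd prime. For $k\ge0$, $(\ell^{ -1})_k=\prod_{j=1}^{k}(1-\ell^{ -j})$, and for $k\ge1$, $r_k=-1/\big(\ell^{k(k+1)/2}(\ell^{ -1})_k\big)$. For a finite set $S$ of nonnegative integers and an integer $i>\max S$ (with $i\ge1$), write $S\cup\{0\}=\{s_0,\dots,s_j\}$ with $0=s_0<\cdots<s_j$, put $s_{j+1}=i$, and set $\rho^i_S=\big|\prod_{k=0}^{j}r_{s_{k+1}-s_k}\big|$. Let $\tau_0=1$, $\tau_1=\rho^1_\varnothing$, and for $i>1$, $\tau_i=\sum_{S\subseteq\{1,\dots,i-1\}}\rho^i_S$. -}

module Defs where

open import Data.Nat as ℕ using (ℕ; zero; suc; _∸_)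
open import Data.Nat.Divisibility using (_∣_)
open import Data.Nat.Primality using (Prime)
open import Data.List using (List; []; _∷_; map; foldr; upTo; _++_)
open import Data.Rational using (ℚ; 0ℚ; 1ℚ; _+_; _*_; _-_; -_; _<_; ∣_∣; 1/_; ≢-nonZero)
open import Data.Rational.Properties using (_≟_)
open import Data.Product using (Σ; ∃-syntax; _×_)
open import Relation.Nullary using (yes; no; ¬_)

ι : ℕ → ℚ
ι n = Data.Rational._/_ (Data.Integer.+_ n) 1
  where import Data.Integer

-- total reciprocal (only ever applied to nonzero arguments below; inv 0 = 0)
inv : ℚ → ℚ
inv p with p ≟ 0ℚ
... | yes _ = 0ℚ
... | no p≢0 = 1/_ p {{≢-nonZero p≢0}}

ℓ^- : ℕ → ℕ → ℚ
ℓ^- ℓ j = inv (ι (ℓ ℕ.^ j))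

poch : ℕ → ℕ → ℚ
poch ℓ zero = 1ℚ
poch ℓ (suc k) = poch ℓ k * (1ℚ - ℓ^- ℓ (suc k))

tri : ℕ → ℕ
tri zero = zero
tri (suc k) = tri k ℕ.+ suc k

-- r_k = -1 / (ℓ^{k(k+1)/2} (ℓ^{-1})_k)   (used for k ≥ 1)
r : ℕ → ℕ → ℚ
r ℓ k = - inv (ι (ℓ ℕ.^ tri k) * poch ℓ k)

prodℚ : List ℚ → ℚ
prodℚ = foldr _*_ 1ℚ

sumℚ : List ℚ → ℚ
sumℚ = foldr _+_ 0ℚ

-- all sublists of a list (order preserved); for an increasing list this
-- enumerates every subset exactly once, each as an increasing list
subsets : List ℕ → List (List ℕ)
subsets [] = [] ∷ []
subsets (x ∷ xs) = map (x ∷_) (subsets xs) ++ subsets xs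

-- given s_0 < s_1 < ... < s_j (as a list starting from s_0) and s_{j+1} = i,
-- the list of r_{s_{k+1} - s_k}, k = 0..j
rFactors : ℕ → ℕ → List ℕ → ℕ → List ℚ
rFactors ℓ s [] i = r ℓ (i ∸ s) ∷ []
rFactors ℓ s (t ∷ ts) i = r ℓ (t ∸ s) ∷ rFactors ℓ t ts i

-- ρ^i_S for S a subset of {1,...,i-1} given as increasing list; s_0 = 0
ρ : ℕ → ℕ → List ℕ → ℚ
ρ ℓ i S = ∣ prodℚ (rFactors ℓ 0 S i) ∣

oneTo : ℕ → List ℕ
oneTo n = map suc (upTo n)

τ : ℕ → ℕ → ℚ
τ ℓ zero = 1ℚ
τ ℓ (suc zero) = ρ ℓ 1 []
τ ℓ (suc (suc n)) = sumℚ (map (ρ ℓ (suc (suc n))) (subsets (oneTo (suc n))))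

partialSum : ℕ → ℕ → ℚ
partialSum ℓ zero = 0ℚ
partialSum ℓ (suc n) = partialSum ℓ n + τ ℓ n

-- convergence of a real series with rational terms: its partial sums form a
-- Cauchy sequence (completeness of ℝ; ℝ = completion of ℚ)
SeriesConverges : (ℕ → ℚ) → Set
SeriesConverges S = ∀ (ε : ℚ) → 0ℚ < ε →
  ∃[ N ] (∀ m n → N ℕ.≤ m → N ℕ.≤ n → ∣ S m - S n ∣ < ε)

OddPrime : ℕ → Set
OddPrime ℓ = Prime ℓ × ¬ (2 ∣ ℓ)

-- Since ℓ^{k(k+1)/2} (ℓ⁻¹)_k = ∏_{j=1}^{k} (ℓ^j − 1), which for ℓ ≥ 3 is at
-- least 2 · 8^{k−1}, every |r_k| is at most 4 · 8^{−k}.  The gaps of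
-- 0 = s_0 < … < s_j < s_{j+1} = i add up to i, so ρ^i_S ≤ 4^{|S|+1} · 8^{−i};
-- summing over the subsets of {1, …, i−1} gives τ_i ≤ 4 · (5/8)^i, and the
-- series is dominated by a convergent geometric series.
module Submission where

open import Data.Empty using (⊥-elim)
open import Data.Integer.Base as ℤ using (+_; -[1+_])
import Data.Integer.Properties as ℤ
open import Data.List.Base using ([]; _∷_; _++_; map; length; upTo)
import Data.List.Properties as List
open import Data.Nat.Base as ℕ using (ℕ; zero; suc; _∸_; z≤n; s≤s; NonZero)
import Data.Nat.Properties as ℕ
open import Data.Nat.Coprimality using (Coprime)
open import Data.Nat.Divisibility using (∣1⇒≡1; ∣-refl)
open import Data.Nat.ListAction using (sum)
open import Data.Nat.ListAction.Properties using (sum-++)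
open import Data.Nat.Primality using (¬prime[0]; ¬prime[1])
import Data.Nat.Solver as ℕ-Solver
open import Data.Product.Base using (_,_; ∃-syntax)
open import Data.Rational.Base as ℚ
  using (ℚ; mkℚ; 0ℚ; 1ℚ; _+_; _*_; _-_; -_; _≤_; _<_; ∣_∣; nonNegative)
open import Data.Rational.Properties
import Data.Rational.Solver as ℚ-Solver
import Data.Rational.Unnormalised.Base as ℚᵘ
import Data.Rational.Unnormalised.Properties as ℚᵘ
open import Data.Sum.Base using (inj₁; inj₂)
open import Relation.Binary.PropositionalEquality
open import Relation.Nullary.Decidable.Core using (yes; no)

open import Defs

coprime-1 : ∀ n → Coprime n 1
coprime-1 n (_ , d∣1) = ∣1⇒≡1 d∣1

ι≡mkℚ : ∀ n → ι n ≡ mkℚ (+ n) 0 (coprime-1 n)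
ι≡mkℚ n = normalize-coprime (coprime-1 n)

ι-homo-* : ∀ m n → ι (m ℕ.* n) ≡ ι m * ι n
ι-homo-* m n rewrite ι≡mkℚ m | ι≡mkℚ n = cong (ℚ._/ 1) (ℤ.pos-* m n)

ι-homo-+ : ∀ m n → ι (m ℕ.+ n) ≡ ι m + ι n
ι-homo-+ m n rewrite ι≡mkℚ m | ι≡mkℚ n = cong (ℚ._/ 1)
  (trans (ℤ.pos-+ m n) (sym (cong₂ ℤ._+_ (ℤ.*-identityʳ (+ m)) (ℤ.*-identityʳ (+ n)))))

ι-mono-≤ : ∀ m n → m ℕ.≤ n → ι m ≤ ι n
ι-mono-≤ m n m≤n rewrite ι≡mkℚ m | ι≡mkℚ n =
  ℚ.*≤* (subst₂ ℤ._≤_ (sym (ℤ.*-identityʳ (+ m))) (sym (ℤ.*-identityʳ (+ n))) (ℤ.+≤+ m≤n))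

ι-mono-< : ∀ m n → m ℕ.< n → ι m < ι n
ι-mono-< m n m<n rewrite ι≡mkℚ m | ι≡mkℚ n =
  ℚ.*<* (subst₂ ℤ._<_ (sym (ℤ.*-identityʳ (+ m))) (sym (ℤ.*-identityʳ (+ n))) (ℤ.+<+ m<n))

ι-nonNeg : ∀ n → 0ℚ ≤ ι n
ι-nonNeg n = ι-mono-≤ 0 n z≤n

ι≢0 : ∀ n → 0 ℕ.< n → ι n ≢ 0ℚ
ι≢0 n 0<n ι≡0 = <-irrefl (sym ι≡0) (ι-mono-< 0 n 0<n)

ι-∸1 : ∀ n → 0 ℕ.< n → ι n - 1ℚ ≡ ι (n ∸ 1)
ι-∸1 (suc m) _ = begin
  ι (suc m) - 1ℚ    ≡⟨ cong (_- 1ℚ) (ι-homo-+ 1 m) ⟩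
  (1ℚ + ι m) - 1ℚ   ≡⟨ solve 2 (λ o x → (o :+ x) :- o := x) refl 1ℚ (ι m) ⟩
  ι m               ∎
  where open ≡-Reasoning
        open ℚ-Solver.+-*-Solver

archimedean : ∀ ε → 0ℚ < ε → ∃[ t ] 1ℚ ≤ ε * ι (suc t)
archimedean (mkℚ (+ zero) _ _)   0<ε = ⊥-elim (ℤ.Positive.pos (ℚ.positive 0<ε))
archimedean (mkℚ -[1+ _ ] _ _)   0<ε = ⊥-elim (ℤ.Positive.pos (ℚ.positive 0<ε))
archimedean ε@(mkℚ (+ suc a) d _) _  =
  d , subst (1ℚ ≤_) (sym ε*ι[1+d]≡ι[1+a]) (ι-mono-≤ 1 (suc a) (s≤s z≤n))
  where
  open ℕ-Solver.+-*-Solver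
  ε*ι[1+d]≡ι[1+a] : ε * ι (suc d) ≡ ι (suc a)
  ε*ι[1+d]≡ι[1+a] rewrite ι≡mkℚ (suc d) | ι≡mkℚ (suc a) = toℚᵘ-injective
    (ℚᵘ.≃-trans (toℚᵘ-homo-* ε (mkℚ (+ suc d) 0 (coprime-1 (suc d))))
      (ℚᵘ.*≡* (cong (λ n → + suc n)
        (solve 2 (λ d a → (d :+ a :* (con 1 :+ d)) :* con 1
                        := d :* con 1 :+ a :* (con 1 :+ d :* con 1)) refl d a))))

*-inv : ∀ p → p ≢ 0ℚ → p * inv p ≡ 1ℚ
*-inv p p≢0 with p ≟ 0ℚ
... | yes p≡0 = ⊥-elim (p≢0 p≡0)
... | no p≢0′ = *-inverseʳ p {{ℚ.≢-nonZero p≢0′}}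

inv-nonNeg : ∀ p → 0ℚ ≤ p → 0ℚ ≤ inv p
inv-nonNeg p 0≤p with p ≟ 0ℚ
... | yes _   = ≤-refl
... | no p≢0 = <⇒≤ (positive⁻¹ _ {{1/pos⇒pos p {{nonNeg∧nonZero⇒pos p}}}})
  where instance
    _ = ℚ.≢-nonZero p≢0
    _ = nonNegative 0≤p

*-[1-inv]≡-1 : ∀ p → p ≢ 0ℚ → p * (1ℚ - inv p) ≡ p - 1ℚ
*-[1-inv]≡-1 p p≢0 = begin
  p * (1ℚ - inv p)     ≡⟨ solve 2 (λ p q → p :* (con 1ℚ :- q) := p :- p :* q) refl p (inv p) ⟩
  p - p * inv p        ≡⟨ cong (λ x → p - x) (*-inv p p≢0) ⟩
  p - 1ℚ               ∎
  where open ≡-Reasoning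
        open ℚ-Solver.+-*-Solver

*-mono-≤-nonNeg : ∀ {a b c d} → 0ℚ ≤ a → 0ℚ ≤ c → a ≤ b → c ≤ d → a * c ≤ b * d
*-mono-≤-nonNeg {b = b} {c} 0≤a 0≤c a≤b c≤d =
  ≤-trans (*-monoʳ-≤-nonNeg c {{nonNegative 0≤c}} a≤b)
          (*-monoˡ-≤-nonNeg b {{nonNegative (≤-trans 0≤a a≤b)}} c≤d)

*-nonNeg : ∀ {p q} → 0ℚ ≤ p → 0ℚ ≤ q → 0ℚ ≤ p * q
*-nonNeg 0≤p 0≤q = *-mono-≤-nonNeg ≤-refl ≤-refl 0≤p 0≤q

∣p-q∣≡∣q-p∣ : ∀ p q → ∣ p - q ∣ ≡ ∣ q - p ∣
∣p-q∣≡∣q-p∣ p q =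
  trans (cong ∣_∣ (solve 2 (λ p q → p :- q := :- (q :- p)) refl p q)) (∣-p∣≡∣p∣ (q - p))
  where open ℚ-Solver.+-*-Solver

<-from-scaled-bound : ∀ {x ε K M T} → 0ℚ ≤ K → 0ℚ ≤ T →
                      x * K ≤ M → M * T < K → 1ℚ ≤ ε * T → x < ε
<-from-scaled-bound {x} {ε} {K} {M} {T} 0≤K 0≤T xK≤M MT<K 1≤εT =
  *-cancelʳ-<-nonNeg (K * T) {{nonNegative (*-nonNeg 0≤K 0≤T)}} (begin-strict
    x * (K * T)   ≡⟨ sym (*-assoc x K T) ⟩
    x * K * T     ≤⟨ *-monoʳ-≤-nonNeg T {{nonNegative 0≤T}} xK≤M ⟩
    M * T         <⟨ MT<K ⟩
    K             ≡⟨ sym (*-identityʳ K) ⟩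
    K * 1ℚ        ≤⟨ *-monoˡ-≤-nonNeg K {{nonNegative 0≤K}} 1≤εT ⟩
    K * (ε * T)   ≡⟨ solve 3 (λ k e t → k :* (e :* t) := e :* (k :* t)) refl K ε T ⟩
    ε * (K * T)   ∎)
  where open ≤-Reasoning
        open ℚ-Solver.+-*-Solver

sumℚ-map-nonNeg : ∀ {A : Set} (f : A → ℚ) xs → (∀ x → 0ℚ ≤ f x) → 0ℚ ≤ sumℚ (map f xs)
sumℚ-map-nonNeg f []       _   = ≤-refl
sumℚ-map-nonNeg f (x ∷ xs) f≥0 = +-mono-≤ (f≥0 x) (sumℚ-map-nonNeg f xs f≥0)

sumℚ-map-*-≤ : ∀ {A : Set} (f g : A → ℚ) c xs →
               (∀ x → f x * c ≤ g x) → sumℚ (map f xs) * c ≤ sumℚ (map g xs)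
sumℚ-map-*-≤ f g c []       _    = ≤-reflexive (*-zeroˡ c)
sumℚ-map-*-≤ f g c (x ∷ xs) fc≤g = ≤-trans (≤-reflexive (*-distribʳ-+ c (f x) (sumℚ (map f xs))))
  (+-mono-≤ (fc≤g x) (sumℚ-map-*-≤ f g c xs fc≤g))

sumℚ-map-ι : ∀ {A : Set} (h : A → ℕ) xs → sumℚ (map (λ x → ι (h x)) xs) ≡ ι (sum (map h xs))
sumℚ-map-ι h []       = refl
sumℚ-map-ι h (x ∷ xs) =
  trans (cong (λ z → ι (h x) + z) (sumℚ-map-ι h xs)) (sym (ι-homo-+ (h x) (sum (map h xs))))

sum-subsets-^length : ∀ c m xs →
  sum (map (λ S → c ℕ.* m ℕ.^ length S) (subsets xs)) ≡ c ℕ.* suc m ℕ.^ length xs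
sum-subsets-^length c m []       = ℕ.+-identityʳ _
sum-subsets-^length c m (x ∷ xs) = begin
  sum (map f (map (x ∷_) A ++ A))
    ≡⟨ cong sum (List.map-++ f (map (x ∷_) A) A) ⟩
  sum (map f (map (x ∷_) A) ++ map f A)
    ≡⟨ sum-++ (map f (map (x ∷_) A)) (map f A) ⟩
  sum (map f (map (x ∷_) A)) ℕ.+ sum (map f A)
    ≡⟨ cong (λ ys → sum ys ℕ.+ sum (map f A)) (sym (List.map-∘ A)) ⟩
  sum (map (λ S → c ℕ.* (m ℕ.* m ℕ.^ length S)) A) ℕ.+ sum (map f A)
    ≡⟨ cong (λ ys → sum ys ℕ.+ sum (map f A))
            (List.map-cong (λ S → sym (ℕ.*-assoc c m (m ℕ.^ length S))) A) ⟩
  sum (map (λ S → c ℕ.* m ℕ.* m ℕ.^ length S) A) ℕ.+ sum (map f A)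
    ≡⟨ cong₂ ℕ._+_ (sum-subsets-^length (c ℕ.* m) m xs) (sum-subsets-^length c m xs) ⟩
  c ℕ.* m ℕ.* p ℕ.+ c ℕ.* p
    ≡⟨ solve 3 (λ c m p → c :* m :* p :+ c :* p := c :* ((con 1 :+ m) :* p)) refl c m p ⟩
  c ℕ.* suc m ℕ.^ length (x ∷ xs) ∎
  where open ≡-Reasoning
        open ℕ-Solver.+-*-Solver
        f = λ S → c ℕ.* m ℕ.^ length S
        A = subsets xs
        p = suc m ℕ.^ length xs

length-oneTo : ∀ n → length (oneTo n) ≡ n
length-oneTo n = trans (List.length-map suc (upTo n)) (List.length-upTo n)

∸-triangle : ∀ i s t → i ∸ s ℕ.≤ (t ∸ s) ℕ.+ (i ∸ t)
∸-triangle i       zero    t       = ℕ.m≤n+m∸n i t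
∸-triangle i       (suc s) zero    = ℕ.m∸n≤m i (suc s)
∸-triangle zero    (suc s) (suc t) = z≤n
∸-triangle (suc i) (suc s) (suc t) = ∸-triangle i s t

5^n*[5+3n]≤5*8^n : ∀ n → 5 ℕ.^ n ℕ.* (5 ℕ.+ 3 ℕ.* n) ℕ.≤ 5 ℕ.* 8 ℕ.^ n
5^n*[5+3n]≤5*8^n zero    = ℕ.≤-refl
5^n*[5+3n]≤5*8^n (suc n) = begin
  5 ℕ.^ suc n ℕ.* (5 ℕ.+ 3 ℕ.* suc n)
    ≡⟨ solve 2 (λ p n → (con 5 :* p) :* (con 5 :+ con 3 :* (con 1 :+ n))
                      := p :* (con 40 :+ con 15 :* n)) refl p n ⟩
  p ℕ.* (40 ℕ.+ 15 ℕ.* n)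
    ≤⟨ ℕ.*-monoʳ-≤ p (ℕ.+-monoʳ-≤ 40 (ℕ.*-monoˡ-≤ n (ℕ.m≤m+n 15 9))) ⟩
  p ℕ.* (40 ℕ.+ 24 ℕ.* n)
    ≡⟨ solve 2 (λ p n → p :* (con 40 :+ con 24 :* n)
                      := con 8 :* (p :* (con 5 :+ con 3 :* n))) refl p n ⟩
  8 ℕ.* (p ℕ.* (5 ℕ.+ 3 ℕ.* n))
    ≤⟨ ℕ.*-monoʳ-≤ 8 (5^n*[5+3n]≤5*8^n n) ⟩
  8 ℕ.* (5 ℕ.* 8 ℕ.^ n)
    ≡⟨ solve 1 (λ q → con 8 :* (con 5 :* q) := con 5 :* (con 8 :* q)) refl (8 ℕ.^ n) ⟩
  5 ℕ.* 8 ℕ.^ suc n ∎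
  where open ℕ.≤-Reasoning
        open ℕ-Solver.+-*-Solver
        p = 5 ℕ.^ n

c≤n⇒c*5^n<3*8^n : ∀ {c n} → c ℕ.≤ n → c ℕ.* 5 ℕ.^ n ℕ.< 3 ℕ.* 8 ℕ.^ n
c≤n⇒c*5^n<3*8^n {c} {n} c≤n = ℕ.*-cancelˡ-< 3 _ _ (begin-strict
  3 ℕ.* (c ℕ.* p)              ≤⟨ ℕ.*-monoʳ-≤ 3 (ℕ.*-monoˡ-≤ p c≤n) ⟩
  3 ℕ.* (n ℕ.* p)              <⟨ ℕ.m<n+m (3 ℕ.* (n ℕ.* p)) (ℕ.m^n>0 5 (suc n)) ⟩
  5 ℕ.* p ℕ.+ 3 ℕ.* (n ℕ.* p)  ≡⟨ solve 2 (λ p n → con 5 :* p :+ con 3 :* (n :* p)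
                                             := p :* (con 5 :+ con 3 :* n)) refl p n ⟩
  p ℕ.* (5 ℕ.+ 3 ℕ.* n)        ≤⟨ 5^n*[5+3n]≤5*8^n n ⟩
  5 ℕ.* 8 ℕ.^ n                ≤⟨ ℕ.*-monoˡ-≤ (8 ℕ.^ n) (ℕ.m≤m+n 5 4) ⟩
  9 ℕ.* 8 ℕ.^ n                ≡⟨ ℕ.*-assoc 3 3 (8 ℕ.^ n) ⟩
  3 ℕ.* (3 ℕ.* 8 ℕ.^ n)        ∎)
  where open ℕ.≤-Reasoning
        open ℕ-Solver.+-*-Solver
        p = 5 ℕ.^ n

module GeometricallyBounded
  (S a : ℕ → ℚ) (C : ℕ)
  (S-suc : ∀ n → S (suc n) ≡ S n + a n)
  (a-nonNeg : ∀ n → 0ℚ ≤ a n)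
  (a-bound : ∀ n → a n * ι (8 ℕ.^ n) ≤ ι (C ℕ.* 5 ℕ.^ n))
  where

  tail-suc : ∀ k n → S (suc k ℕ.+ n) - S n ≡ a n + (S (k ℕ.+ suc n) - S (suc n))
  tail-suc k n = begin
    S (suc k ℕ.+ n) - S n           ≡⟨ cong (λ j → S j - S n) (sym (ℕ.+-suc k n)) ⟩
    T - S n                         ≡⟨ solve 3 (λ t s x → t :- s := x :+ (t :- (s :+ x))) refl T (S n) (a n) ⟩
    a n + (T - (S n + a n))         ≡⟨ cong (λ y → a n + (T - y)) (sym (S-suc n)) ⟩
    a n + (T - S (suc n))           ∎
    where open ≡-Reasoning
          open ℚ-Solver.+-*-Solver
          T = S (k ℕ.+ suc n)

  tail-nonNeg : ∀ k n → 0ℚ ≤ S (k ℕ.+ n) - S n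
  tail-nonNeg zero    n = ≤-reflexive (sym (+-inverseʳ (S n)))
  tail-nonNeg (suc k) n =
    subst (0ℚ ≤_) (sym (tail-suc k n)) (+-mono-≤ (a-nonNeg n) (tail-nonNeg k (suc n)))

  -- The constant 8/3 is 1 / (1 − 5/8).
  tail-bound : ∀ k n → (S (k ℕ.+ n) - S n) * ι (3 ℕ.* 8 ℕ.^ n) ≤ ι (8 ℕ.* C ℕ.* 5 ℕ.^ n)
  tail-bound zero n = begin
    (S n - S n) * ι (3 ℕ.* 8 ℕ.^ n)  ≡⟨ cong (_* ι (3 ℕ.* 8 ℕ.^ n)) (+-inverseʳ (S n)) ⟩
    0ℚ * ι (3 ℕ.* 8 ℕ.^ n)           ≡⟨ *-zeroˡ (ι (3 ℕ.* 8 ℕ.^ n)) ⟩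
    0ℚ                               ≤⟨ ι-nonNeg (8 ℕ.* C ℕ.* 5 ℕ.^ n) ⟩
    ι (8 ℕ.* C ℕ.* 5 ℕ.^ n)          ∎
    where open ≤-Reasoning
  tail-bound (suc k) n =
    *-cancelˡ-≤-pos (ι 8) {{ℚ.positive (ι-mono-< 0 8 (s≤s z≤n))}} (begin
      ι 8 * ((S (suc k ℕ.+ n) - S n) * ι (3 ℕ.* e))
        ≡⟨ cong (λ z → ι 8 * (z * ι (3 ℕ.* e))) (tail-suc k n) ⟩
      ι 8 * ((x + T) * ι (3 ℕ.* e))
        ≡⟨ cong (λ z → ι 8 * ((x + T) * z)) (ι-homo-* 3 e) ⟩
      ι 8 * ((x + T) * (ι 3 * ι e))
        ≡⟨ solve 5 (λ i j x t e → i :* ((x :+ t) :* (j :* e))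
                                := (i :* j) :* (x :* e) :+ t :* (j :* (i :* e))) refl
                   (ι 8) (ι 3) x T (ι e) ⟩
      (ι 8 * ι 3) * (x * ι e) + T * (ι 3 * (ι 8 * ι e))
        ≡⟨ cong₂ (λ u v → u * (x * ι e) + T * v) (sym (ι-homo-* 8 3))
                 (sym (trans (ι-homo-* 3 (8 ℕ.* e)) (cong (ι 3 *_) (ι-homo-* 8 e)))) ⟩
      ι 24 * (x * ι e) + T * ι (3 ℕ.* 8 ℕ.^ suc n)
        ≤⟨ +-mono-≤ (*-monoˡ-≤-nonNeg (ι 24) {{nonNegative (ι-nonNeg 24)}} (a-bound n))
                    (tail-bound k (suc n)) ⟩
      ι 24 * ι (C ℕ.* p) + ι (8 ℕ.* C ℕ.* 5 ℕ.^ suc n)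
        ≡⟨ cong (_+ ι (8 ℕ.* C ℕ.* 5 ℕ.^ suc n)) (sym (ι-homo-* 24 (C ℕ.* p))) ⟩
      ι (24 ℕ.* (C ℕ.* p)) + ι (8 ℕ.* C ℕ.* 5 ℕ.^ suc n)
        ≡⟨ sym (ι-homo-+ (24 ℕ.* (C ℕ.* p)) (8 ℕ.* C ℕ.* 5 ℕ.^ suc n)) ⟩
      ι (24 ℕ.* (C ℕ.* p) ℕ.+ 8 ℕ.* C ℕ.* (5 ℕ.* p))
        ≡⟨ cong ι (N.solve 2 (λ c p →
              N.con 24 N.:* (c N.:* p) N.:+ N.con 8 N.:* c N.:* (N.con 5 N.:* p)
              N.:= N.con 8 N.:* (N.con 8 N.:* c N.:* p)) refl C p) ⟩
      ι (8 ℕ.* (8 ℕ.* C ℕ.* p))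
        ≡⟨ ι-homo-* 8 (8 ℕ.* C ℕ.* p) ⟩
      ι 8 * ι (8 ℕ.* C ℕ.* 5 ℕ.^ n) ∎)
    where open ≤-Reasoning
          open ℚ-Solver.+-*-Solver
          module N = ℕ-Solver.+-*-Solver
          x = a n
          T = S (k ℕ.+ suc n) - S (suc n)
          e = 8 ℕ.^ n
          p = 5 ℕ.^ n

  converges : SeriesConverges S
  converges ε 0<ε with archimedean ε 0<ε
  ... | t , 1≤ε*ι[1+t] = N , close
    where
    N = 8 ℕ.* C ℕ.* suc t

    close-tail : ∀ k n → N ℕ.≤ n → ∣ S (k ℕ.+ n) - S n ∣ < ε
    close-tail k n N≤n =
      <-from-scaled-bound (ι-nonNeg (3 ℕ.* 8 ℕ.^ n)) (ι-nonNeg (suc t)) bound small 1≤ε*ι[1+t]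
      where
      open ℕ-Solver.+-*-Solver
      bound : ∣ S (k ℕ.+ n) - S n ∣ * ι (3 ℕ.* 8 ℕ.^ n) ≤ ι (8 ℕ.* C ℕ.* 5 ℕ.^ n)
      bound rewrite 0≤p⇒∣p∣≡p (tail-nonNeg k n) = tail-bound k n
      small : ι (8 ℕ.* C ℕ.* 5 ℕ.^ n) * ι (suc t) < ι (3 ℕ.* 8 ℕ.^ n)
      small = subst (_< ι (3 ℕ.* 8 ℕ.^ n)) (ι-homo-* (8 ℕ.* C ℕ.* 5 ℕ.^ n) (suc t))
        (ι-mono-< (8 ℕ.* C ℕ.* 5 ℕ.^ n ℕ.* suc t) (3 ℕ.* 8 ℕ.^ n) (subst (ℕ._< 3 ℕ.* 8 ℕ.^ n)
          (solve 3 (λ c t p → con 8 :* c :* t :* p := con 8 :* c :* p :* t) refl C (suc t) (5 ℕ.^ n))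
          (c≤n⇒c*5^n<3*8^n N≤n)))

    close : ∀ m n → N ℕ.≤ m → N ℕ.≤ n → ∣ S m - S n ∣ < ε
    close m n N≤m N≤n with ℕ.≤-total n m
    ... | inj₁ n≤m = subst (λ j → ∣ S j - S n ∣ < ε) (ℕ.m∸n+n≡m n≤m) (close-tail (m ∸ n) n N≤n)
    ... | inj₂ m≤n = subst (_< ε) (∣p-q∣≡∣q-p∣ (S n) (S m))
                       (subst (λ j → ∣ S j - S m ∣ < ε) (ℕ.m∸n+n≡m m≤n) (close-tail (n ∸ m) m N≤m))

denom : ℕ → ℕ → ℕ
denom ℓ zero    = 1
denom ℓ (suc k) = denom ℓ k ℕ.* (ℓ ℕ.^ suc k ∸ 1)

ι-denom : ∀ ℓ .{{_ : NonZero ℓ}} k → ι (ℓ ℕ.^ tri k) * poch ℓ k ≡ ι (denom ℓ k)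
ι-denom ℓ zero    = *-identityʳ _
ι-denom ℓ (suc k) = begin
  ι (ℓ ℕ.^ (tri k ℕ.+ suc k)) * (poch ℓ k * (1ℚ - inv (ι m)))
    ≡⟨ cong (_* (poch ℓ k * (1ℚ - inv (ι m))))
            (trans (cong ι (ℕ.^-distribˡ-+-* ℓ (tri k) (suc k))) (ι-homo-* A m)) ⟩
  (ι A * ι m) * (poch ℓ k * (1ℚ - inv (ι m)))
    ≡⟨ solve 4 (λ a b c d → (a :* b) :* (c :* d) := (a :* c) :* (b :* d)) refl
               (ι A) (ι m) (poch ℓ k) (1ℚ - inv (ι m)) ⟩
  (ι A * poch ℓ k) * (ι m * (1ℚ - inv (ι m)))
    ≡⟨ cong₂ _*_ (ι-denom ℓ k) (*-[1-inv]≡-1 (ι m) (ι≢0 m 0<m)) ⟩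
  ι (denom ℓ k) * (ι m - 1ℚ)
    ≡⟨ cong (ι (denom ℓ k) *_) (ι-∸1 m 0<m) ⟩
  ι (denom ℓ k) * ι (m ∸ 1)
    ≡⟨ sym (ι-homo-* (denom ℓ k) (m ∸ 1)) ⟩
  ι (denom ℓ (suc k)) ∎
  where open ≡-Reasoning
        open ℚ-Solver.+-*-Solver
        m = ℓ ℕ.^ suc k
        A = ℓ ℕ.^ tri k
        0<m = ℕ.m^n>0 ℓ (suc k)

∣r∣≡inv-denom : ∀ ℓ .{{_ : NonZero ℓ}} k → ∣ r ℓ k ∣ ≡ inv (ι (denom ℓ k))
∣r∣≡inv-denom ℓ k = begin
  ∣ - inv (ι (ℓ ℕ.^ tri k) * poch ℓ k) ∣ ≡⟨ ∣-p∣≡∣p∣ _ ⟩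
  ∣ inv (ι (ℓ ℕ.^ tri k) * poch ℓ k) ∣   ≡⟨ cong (λ z → ∣ inv z ∣) (ι-denom ℓ k) ⟩
  ∣ inv (ι (denom ℓ k)) ∣                ≡⟨ 0≤p⇒∣p∣≡p (inv-nonNeg _ (ι-nonNeg (denom ℓ k))) ⟩
  inv (ι (denom ℓ k))                    ∎
  where open ≡-Reasoning

module _ (ℓ : ℕ) (3≤ℓ : 3 ℕ.≤ ℓ) where

  private instance
    ℓ≢0 : NonZero ℓ
    ℓ≢0 = ℕ.>-nonZero (ℕ.≤-trans (s≤s z≤n) 3≤ℓ)

  2≤ℓ^[1+k]∸1 : ∀ k → 2 ℕ.≤ ℓ ℕ.^ suc k ∸ 1
  2≤ℓ^[1+k]∸1 k = ℕ.∸-monoˡ-≤ 1 (ℕ.*-mono-≤ 3≤ℓ (ℕ.m^n>0 ℓ k))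

  8≤ℓ^[2+k]∸1 : ∀ k → 8 ℕ.≤ ℓ ℕ.^ (2 ℕ.+ k) ∸ 1
  8≤ℓ^[2+k]∸1 k = ℕ.∸-monoˡ-≤ 1
    (ℕ.≤-trans (ℕ.^-monoʳ-≤ 3 (ℕ.m≤m+n 2 k)) (ℕ.^-monoˡ-≤ (2 ℕ.+ k) 3≤ℓ))

  denom-pos : ∀ k → 0 ℕ.< denom ℓ k
  denom-pos zero    = s≤s z≤n
  denom-pos (suc k) = ℕ.*-mono-< (denom-pos k) (ℕ.≤-trans (s≤s z≤n) (2≤ℓ^[1+k]∸1 k))

  8^k≤4*denom : ∀ k → 8 ℕ.^ k ℕ.≤ 4 ℕ.* denom ℓ k
  8^k≤4*denom zero          = s≤s z≤n
  8^k≤4*denom (suc zero)    = ℕ.*-monoʳ-≤ 4 (subst (2 ℕ.≤_) (sym (ℕ.*-identityˡ _)) (2≤ℓ^[1+k]∸1 0))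
  8^k≤4*denom (suc (suc k)) = begin
    8 ℕ.* 8 ℕ.^ suc k    ≤⟨ ℕ.*-monoʳ-≤ 8 (8^k≤4*denom (suc k)) ⟩
    8 ℕ.* (4 ℕ.* Q)      ≡⟨ solve 1 (λ q → con 8 :* (con 4 :* q) := con 4 :* (q :* con 8)) refl Q ⟩
    4 ℕ.* (Q ℕ.* 8)      ≤⟨ ℕ.*-monoʳ-≤ 4 (ℕ.*-monoʳ-≤ Q (8≤ℓ^[2+k]∸1 k)) ⟩
    4 ℕ.* denom ℓ (suc (suc k)) ∎
    where open ℕ.≤-Reasoning
          open ℕ-Solver.+-*-Solver
          Q = denom ℓ (suc k)

  ∣r∣*8^k≤4 : ∀ k → ∣ r ℓ k ∣ * ι (8 ℕ.^ k) ≤ ι 4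
  ∣r∣*8^k≤4 k = begin
    ∣ r ℓ k ∣ * ι (8 ℕ.^ k)  ≡⟨ cong (_* ι (8 ℕ.^ k)) (∣r∣≡inv-denom ℓ k) ⟩
    d⁻¹ * ι (8 ℕ.^ k)        ≤⟨ *-monoˡ-≤-nonNeg d⁻¹ {{nonNegative (inv-nonNeg _ (ι-nonNeg D))}}
                                  (ι-mono-≤ (8 ℕ.^ k) (4 ℕ.* D) (8^k≤4*denom k)) ⟩
    d⁻¹ * ι (4 ℕ.* D)        ≡⟨ cong (d⁻¹ *_) (ι-homo-* 4 D) ⟩
    d⁻¹ * (ι 4 * ι D)        ≡⟨ solve 3 (λ a b c → a :* (b :* c) := b :* (c :* a)) refl d⁻¹ (ι 4) (ι D) ⟩
    ι 4 * (ι D * d⁻¹)        ≡⟨ cong (ι 4 *_) (*-inv _ (ι≢0 D (denom-pos k))) ⟩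
    ι 4 * 1ℚ                 ≡⟨ *-identityʳ _ ⟩
    ι 4                      ∎
    where open ≤-Reasoning
          open ℚ-Solver.+-*-Solver
          D = denom ℓ k
          d⁻¹ = inv (ι D)

  ∣∏rFactors∣*8^[i∸s]≤4^[1+|S|] : ∀ s S i →
    ∣ prodℚ (rFactors ℓ s S i) ∣ * ι (8 ℕ.^ (i ∸ s)) ≤ ι (4 ℕ.^ suc (length S))
  ∣∏rFactors∣*8^[i∸s]≤4^[1+|S|] s [] i =
    ≤-trans (≤-reflexive (cong (λ z → ∣ z ∣ * ι (8 ℕ.^ (i ∸ s))) (*-identityʳ (r ℓ (i ∸ s)))))
            (∣r∣*8^k≤4 (i ∸ s))
  ∣∏rFactors∣*8^[i∸s]≤4^[1+|S|] s (t ∷ ts) i = begin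
    ∣ x * y ∣ * ι (8 ℕ.^ (i ∸ s))
      ≡⟨ cong (_* ι (8 ℕ.^ (i ∸ s))) (∣p*q∣≡∣p∣*∣q∣ x y) ⟩
    (∣ x ∣ * ∣ y ∣) * ι (8 ℕ.^ (i ∸ s))
      ≤⟨ *-monoˡ-≤-nonNeg (∣ x ∣ * ∣ y ∣) {{nonNegative (*-nonNeg (0≤∣p∣ x) (0≤∣p∣ y))}}
           (ι-mono-≤ (8 ℕ.^ (i ∸ s)) (8 ℕ.^ (t ∸ s) ℕ.* 8 ℕ.^ (i ∸ t)) 8^[i∸s]≤8^[t∸s]*8^[i∸t]) ⟩
    (∣ x ∣ * ∣ y ∣) * ι (8 ℕ.^ (t ∸ s) ℕ.* 8 ℕ.^ (i ∸ t))
      ≡⟨ cong ((∣ x ∣ * ∣ y ∣) *_) (ι-homo-* (8 ℕ.^ (t ∸ s)) (8 ℕ.^ (i ∸ t))) ⟩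
    (∣ x ∣ * ∣ y ∣) * (ι (8 ℕ.^ (t ∸ s)) * ι (8 ℕ.^ (i ∸ t)))
      ≡⟨ solve 4 (λ a b c d → (a :* b) :* (c :* d) := (a :* c) :* (b :* d)) refl
                 ∣ x ∣ ∣ y ∣ (ι (8 ℕ.^ (t ∸ s))) (ι (8 ℕ.^ (i ∸ t))) ⟩
    (∣ x ∣ * ι (8 ℕ.^ (t ∸ s))) * (∣ y ∣ * ι (8 ℕ.^ (i ∸ t)))
      ≤⟨ *-mono-≤-nonNeg (*-nonNeg (0≤∣p∣ x) (ι-nonNeg (8 ℕ.^ (t ∸ s))))
                         (*-nonNeg (0≤∣p∣ y) (ι-nonNeg (8 ℕ.^ (i ∸ t))))
                         (∣r∣*8^k≤4 (t ∸ s)) (∣∏rFactors∣*8^[i∸s]≤4^[1+|S|] t ts i) ⟩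
    ι 4 * ι (4 ℕ.^ suc (length ts))
      ≡⟨ sym (ι-homo-* 4 (4 ℕ.^ suc (length ts))) ⟩
    ι (4 ℕ.^ suc (length (t ∷ ts))) ∎
    where open ≤-Reasoning
          open ℚ-Solver.+-*-Solver
          x = r ℓ (t ∸ s)
          y = prodℚ (rFactors ℓ t ts i)
          8^[i∸s]≤8^[t∸s]*8^[i∸t] : 8 ℕ.^ (i ∸ s) ℕ.≤ 8 ℕ.^ (t ∸ s) ℕ.* 8 ℕ.^ (i ∸ t)
          8^[i∸s]≤8^[t∸s]*8^[i∸t] = ℕ.≤-trans (ℕ.^-monoʳ-≤ 8 (∸-triangle i s t))
                                              (ℕ.≤-reflexive (ℕ.^-distribˡ-+-* 8 (t ∸ s) (i ∸ t)))

  τ-bound : ∀ i → τ ℓ i * ι (8 ℕ.^ i) ≤ ι (4 ℕ.* 5 ℕ.^ i)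
  τ-bound zero          = ι-mono-≤ 1 4 (s≤s z≤n)
  τ-bound (suc zero)    = ≤-trans (∣∏rFactors∣*8^[i∸s]≤4^[1+|S|] 0 [] 1) (ι-mono-≤ 4 20 (ℕ.m≤m+n 4 16))
  τ-bound (suc (suc n)) = begin
    sumℚ (map (ρ ℓ i) (subsets L)) * ι (8 ℕ.^ i)
      ≤⟨ sumℚ-map-*-≤ (ρ ℓ i) (λ S → ι (4 ℕ.^ suc (length S))) (ι (8 ℕ.^ i)) (subsets L)
                      (λ S → ∣∏rFactors∣*8^[i∸s]≤4^[1+|S|] 0 S i) ⟩
    sumℚ (map (λ S → ι (4 ℕ.^ suc (length S))) (subsets L))
      ≡⟨ sumℚ-map-ι (λ S → 4 ℕ.^ suc (length S)) (subsets L) ⟩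
    ι (sum (map (λ S → 4 ℕ.* 4 ℕ.^ length S) (subsets L)))
      ≡⟨ cong ι (sum-subsets-^length 4 4 L) ⟩
    ι (4 ℕ.* 5 ℕ.^ length L)
      ≡⟨ cong (λ j → ι (4 ℕ.* 5 ℕ.^ j)) (length-oneTo (suc n)) ⟩
    ι (4 ℕ.* 5 ℕ.^ suc n)
      ≤⟨ ι-mono-≤ (4 ℕ.* 5 ℕ.^ suc n) (4 ℕ.* 5 ℕ.^ i) (ℕ.*-monoʳ-≤ 4 (ℕ.m≤n*m (5 ℕ.^ suc n) 5)) ⟩
    ι (4 ℕ.* 5 ℕ.^ i) ∎
    where open ≤-Reasoning
          i = suc (suc n)
          L = oneTo (suc n)

  τ-nonNeg : ∀ i → 0ℚ ≤ τ ℓ i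
  τ-nonNeg zero          = ι-nonNeg 1
  τ-nonNeg (suc zero)    = 0≤∣p∣ _
  τ-nonNeg (suc (suc n)) = sumℚ-map-nonNeg (ρ ℓ (suc (suc n))) (subsets (oneTo (suc n))) (λ _ → 0≤∣p∣ _)

oddPrime⇒3≤ : ∀ ℓ → OddPrime ℓ → 3 ℕ.≤ ℓ
oddPrime⇒3≤ 0                   (p , _)   = ⊥-elim (¬prime[0] p)
oddPrime⇒3≤ 1                   (p , _)   = ⊥-elim (¬prime[1] p)
oddPrime⇒3≤ 2                   (_ , odd) = ⊥-elim (odd ∣-refl)
oddPrime⇒3≤ (suc (suc (suc _))) _         = s≤s (s≤s (s≤s z≤n))

mainTheorem13 : (ℓ : ℕ) → OddPrime ℓ → SeriesConverges (partialSum ℓ)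
mainTheorem13 ℓ oddPrime =
  GeometricallyBounded.converges (partialSum ℓ) (τ ℓ) 4 (λ _ → refl) (τ-nonNeg ℓ 3≤ℓ) (τ-bound ℓ 3≤ℓ)
  where 3≤ℓ = oddPrime⇒3≤ ℓ oddPrime
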